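{- Let $G$ be a finite abelian group, $\mathcal{E}\subset G$ a subgroup of index $2$, $\mathcal{O}=G\setminus\mathcal{E}$. For every $x,y\in\mathcal{E}$ with $x\notin\{y,-y\}$, $|E(\mathcal{G}_x)\cap E(\mathcal{G}_y)|\leqslant 2\,r(\mathcal{E})$.
   Context: $r(\mathcal{E})$ is the number of $x\in\mathcal{E}$ with $x=-x$. For $x\in\mathcal{E}$, $\mathcal{G}_x$ is the graph with vertex set $\mathcal{O}$ and edge set $E(\mathcal{G}_x)=\{\{a,b\}:a\neq b\in\mathcal{O},\ a+b=x\text{ or }a-b=x\}$. -}

module Defs where

open import Data.Nat using (ℕ; _*_)
open import Data.Fin using (Fin; _<_; _<?_)
open import Data.Fin.Properties using (_≟_)
open import Data.Fin.Subset using (Subset; _∈_; _∉_; ∣_∣)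
open import Data.Fin.Subset.Properties using (_∈?_)
open import Data.List using (List; length; filter; allFin; concatMap; map)
open import Data.Product using (_×_; _,_; proj₁; proj₂)
open import Data.Sum using (_⊎_)
open import Relation.Nullary using (¬_; Dec; yes; no)
open import Relation.Nullary.Decidable using (_×-dec_; _⊎-dec_; ¬?)
open import Relation.Binary.PropositionalEquality using (_≡_; _≢_)
open import Algebra.Core using (Op₁; Op₂)
open import Algebra.Structures using (IsAbelianGroup)

-- A finite abelian group of order n, with carrier Fin n
-- (every finite abelian group is isomorphic to one of this form).
record FinAbGroup (n : ℕ) : Set where
  field
    _+_ : Op₂ (Fin n)
    0# : Fin n
    -_ : Op₁ (Fin n)
    isAbelianGroup : IsAbelianGroup _≡_ _+_ 0# -_
  infixl 6 _+_
  infix 8 -_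

  _-_ : Op₂ (Fin n)
  a - b = a + (- b)
  infixl 6 _-_

module _ {n : ℕ} (G : FinAbGroup n) where
  open FinAbGroup G

  record IsSubgroup (E : Subset n) : Set where
    field
      zero-closed : 0# ∈ E
      +-closed : ∀ {a b} → a ∈ E → b ∈ E → (a + b) ∈ E
      neg-closed : ∀ {a} → a ∈ E → (- a) ∈ E

  -- E is a subgroup of index 2 ([G : E] = |G| / |E| = 2, G finite)
  record IsIndex2Subgroup (E : Subset n) : Set where
    field
      isSubgroup : IsSubgroup E
      index2 : 2 * ∣ E ∣ ≡ n

  r : Subset n → ℕ
  r E = length (filter (λ x → (x ∈? E) ×-dec (x ≟ (- x))) (allFin n))

  -- {a,b} is an edge of the graph 𝒢_x on vertex set 𝒪 = G ∖ E:
  -- a ≠ b in 𝒪 and a + b = x or a - b = x (for some ordering of the pair)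
  IsEdge : Subset n → Fin n → Fin n → Fin n → Set
  IsEdge E x a b =
    (a ∉ E) × (b ∉ E) × (a ≢ b) ×
    ((a + b ≡ x) ⊎ (a - b ≡ x) ⊎ (b - a ≡ x))

  isEdge? : ∀ E x a b → Dec (IsEdge E x a b)
  isEdge? E x a b =
    ¬? (a ∈? E) ×-dec ¬? (b ∈? E) ×-dec ¬? (a ≟ b) ×-dec
    ((a + b ≟ x) ⊎-dec (a - b ≟ x) ⊎-dec (b - a ≟ x))

  -- unordered pairs {a,b} of distinct elements, represented as (a,b) with a < b
  orderedPairs : List (Fin n × Fin n)
  orderedPairs =
    filter (λ p → proj₁ p <? proj₂ p)
      (concatMap (λ a → map (λ b → a , b) (allFin n)) (allFin n))

  commonEdges : Subset n → Fin n → Fin n → ℕ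
  commonEdges E x y =
    length (filter (λ p → isEdge? E x (proj₁ p) (proj₂ p) ×-dec isEdge? E y (proj₁ p) (proj₂ p))
      orderedPairs)

-- A common edge {a, b} of 𝒢_x and 𝒢_y has one of x, y as its sum a + b and the other as
-- ±(a − b) (two sums or two differences would force x = y or x = −y).  Adding the two
-- relations gives an endpoint u with u + u = x + y, and the sum together with u determines
-- the edge.  Hence there are at most 2·|H| common edges, H = {u ∈ 𝒪 : u + u = x + y}.
-- Since E has index 2, 𝒪 is a single coset of E; so for a fixed u₀ ∈ H the map
-- u ↦ u − u₀ sends H injectively into {t ∈ E : t = −t}, and |H| ≤ r(E).
module Submission where

open import Defs
open import Level using (Level; 0ℓ)
open import Data.Nat using (ℕ; _≤_; _*_; suc; z≤n; s≤s)
import Data.Nat as ℕ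
open import Data.Nat.Properties
  using (+-suc; +-identityʳ; +-cancelˡ-≡; ≤-trans; *-monoʳ-≤; <-irrefl; module ≤-Reasoning)
open import Data.Fin using (Fin; _<_; _<?_)
import Data.Fin as Fin
open import Data.Fin.Properties using (_≟_; <-asym)
open import Data.Fin.Subset using (Subset; _∈_; _∉_; ∣_∣; inside; outside)
open import Data.Fin.Subset.Properties using (_∈?_)
open import Data.Vec using ([]; _∷_)
open import Data.Bool using (true; false; if_then_else_)
open import Data.List
  using (List; []; _∷_; length; filter; map; _++_; tabulate; allFin; concatMap; cartesianProduct)
open import Data.List.Properties
  using (length-map; length-++; length-++-sucʳ; length-tabulate; map-tabulate)
open import Data.List.Membership.Propositional using () renaming (_∈_ to _∈ₗ_)
open import Data.List.Membership.Propositional.Properties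
  using (∈-∃++; ∈-++⁻; ∈-++⁺ˡ; ∈-++⁺ʳ; ∈-map⁻; ∈-filter⁺; ∈-filter⁻; ∈-allFin; ∈-cartesianProduct⁺)
open import Data.List.Relation.Unary.Any using (here; there)
open import Data.List.Relation.Unary.All using (All)
import Data.List.Relation.Unary.All as All
open import Data.List.Relation.Unary.AllPairs using (_∷_)
open import Data.List.Relation.Unary.Unique.Propositional using (Unique)
open import Data.List.Relation.Unary.Unique.Propositional.Properties
  using (map⁺; filter⁺; allFin⁺; cartesianProduct⁺)
open import Data.Product using (_×_; _,_; proj₁; proj₂)
open import Data.Sum using (_⊎_; inj₁; inj₂; [_,_]′)
import Data.Sum as Sum
open import Data.Empty using (⊥-elim)
open import Relation.Nullary using (yes; no; does; ¬?)
open import Relation.Nullary.Decidable using (_×-dec_; decidable-stable)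
open import Relation.Unary using (Pred; Decidable)
open import Relation.Unary.Properties using (∁?)
open import Relation.Binary.PropositionalEquality
  using (_≡_; _≢_; refl; sym; trans; cong; cong₂; subst; module ≡-Reasoning)
open import Algebra.Bundles using (AbelianGroup)
import Algebra.Properties.AbelianGroup as AbelianGroupProperties
import Algebra.Properties.CommutativeSemigroup as CommutativeSemigroupProperties

private
  variable
    ℓ₁ ℓ₂ : Level
    A : Set ℓ₁
    B : Set ℓ₂

length-filter+length-filter-∁ : ∀ {p} {P : Pred A p} (P? : Decidable P) (xs : List A) →
  length (filter P? xs) ℕ.+ length (filter (∁? P?) xs) ≡ length xs
length-filter+length-filter-∁ P? [] = refl
length-filter+length-filter-∁ P? (x ∷ xs) with P? x
... | yes _ = cong suc (length-filter+length-filter-∁ P? xs)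
... | no _  = trans (+-suc _ _) (cong suc (length-filter+length-filter-∁ P? xs))

length-cartesianProduct : (xs : List A) (ys : List B) →
  length (cartesianProduct xs ys) ≡ length xs * length ys
length-cartesianProduct []       ys = refl
length-cartesianProduct (x ∷ xs) ys = begin
  length (map (x ,_) ys ++ cartesianProduct xs ys)
    ≡⟨ length-++ (map (x ,_) ys) ⟩
  length (map (x ,_) ys) ℕ.+ length (cartesianProduct xs ys)
    ≡⟨ cong₂ ℕ._+_ (length-map (x ,_) ys) (length-cartesianProduct xs ys) ⟩
  length ys ℕ.+ length xs * length ys ∎
  where open ≡-Reasoning

concatMap-pairs≡cartesianProduct : (xs : List A) (ys : List B) →
  concatMap (λ x → map (x ,_) ys) xs ≡ cartesianProduct xs ys
concatMap-pairs≡cartesianProduct []       ys = refl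
concatMap-pairs≡cartesianProduct (x ∷ xs) ys =
  cong (map (x ,_) ys ++_) (concatMap-pairs≡cartesianProduct xs ys)

injectiveOn⇒length≤ : (f : A → B) {xs : List A} {ys : List B} → Unique xs →
  (∀ {u v} → u ∈ₗ xs → v ∈ₗ xs → f u ≡ f v → u ≡ v) →
  (∀ {u} → u ∈ₗ xs → f u ∈ₗ ys) →
  length xs ≤ length ys
injectiveOn⇒length≤ f {[]}     _              _   _    = z≤n
injectiveOn⇒length≤ f {x ∷ xs} (x∉xs ∷ xs-uq) inj into with ∈-∃++ (into (here refl))
... | us , vs , refl = subst (suc (length xs) ≤_) (sym (length-++-sucʳ us (f x) vs))
  (s≤s (injectiveOn⇒length≤ f xs-uq (λ u∈ v∈ → inj (there u∈) (there v∈)) into-us++vs))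
  where
  into-us++vs : ∀ {u} → u ∈ₗ xs → f u ∈ₗ (us ++ vs)
  into-us++vs {u} u∈ with ∈-++⁻ us (into (there u∈))
  ... | inj₁ fu∈us         = ∈-++⁺ˡ fu∈us
  ... | inj₂ (here fu≡fx)  = ⊥-elim (All.lookup x∉xs u∈ (inj (here refl) (there u∈) (sym fu≡fx)))
  ... | inj₂ (there fu∈vs) = ∈-++⁺ʳ us fu∈vs

length-filter-∈-∷-map-suc : ∀ {m} s (p : Subset m) (xs : List (Fin m)) →
  length (filter (_∈? (s ∷ p)) (map Fin.suc xs)) ≡ length (filter (_∈? p) xs)
length-filter-∈-∷-map-suc s p [] = refl
length-filter-∈-∷-map-suc s p (x ∷ xs) with does (x ∈? p)
... | true  = cong suc (length-filter-∈-∷-map-suc s p xs)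
... | false = length-filter-∈-∷-map-suc s p xs

length-filter-∈-∷-allFin-suc : ∀ {m} s (p : Subset m) →
  length (filter (_∈? (s ∷ p)) (tabulate Fin.suc)) ≡ length (filter (_∈? p) (allFin m))
length-filter-∈-∷-allFin-suc {m} s p = trans
  (cong (λ zs → length (filter (_∈? (s ∷ p)) zs)) (sym (map-tabulate (λ i → i) Fin.suc)))
  (length-filter-∈-∷-map-suc s p (allFin m))

length-filter-∈-allFin : ∀ {m} (p : Subset m) → length (filter (_∈? p) (allFin m)) ≡ ∣ p ∣
length-filter-∈-allFin []            = refl
length-filter-∈-allFin (inside ∷ p)  =
  cong suc (trans (length-filter-∈-∷-allFin-suc inside p) (length-filter-∈-allFin p))
length-filter-∈-allFin (outside ∷ p) =
  trans (length-filter-∈-∷-allFin-suc outside p) (length-filter-∈-allFin p)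

module _ {n : ℕ} (G : FinAbGroup n) where
  open FinAbGroup G

  abelianGroup : AbelianGroup 0ℓ 0ℓ
  abelianGroup = record { isAbelianGroup = isAbelianGroup }

  open AbelianGroup abelianGroup using (comm; inverseʳ; identityʳ; commutativeSemigroup)
  open AbelianGroupProperties abelianGroup
    using (∙-cancelˡ; ∙-cancelʳ; ⁻¹-anti-homo‿-; ⁻¹-∙-comm; xyx⁻¹≈y; //-rightDividesʳ; inverseˡ-unique)
  open CommutativeSemigroupProperties commutativeSemigroup using (interchange)

  sum+difference≡double : ∀ a b → (a + b) + (a - b) ≡ a + a
  sum+difference≡double a b = begin
    (a + b) + (a - b)  ≡⟨ interchange a b a (- b) ⟩
    (a + a) + (b - b)  ≡⟨ cong ((a + a) +_) (inverseʳ b) ⟩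
    (a + a) + 0#       ≡⟨ identityʳ (a + a) ⟩
    a + a              ∎
    where open ≡-Reasoning

  doubles≡⇒difference-selfInverse : ∀ u v → u + u ≡ v + v → u - v ≡ - (u - v)
  doubles≡⇒difference-selfInverse u v uu≡vv = inverseˡ-unique (u - v) (u - v) (begin
    (u - v) + (u - v)      ≡⟨ interchange u (- v) u (- v) ⟩
    (u + u) + (- v + - v)  ≡⟨ cong ((u + u) +_) (⁻¹-∙-comm v v) ⟩
    (u + u) - (v + v)      ≡⟨ cong (_- (v + v)) uu≡vv ⟩
    (v + v) - (v + v)      ≡⟨ inverseʳ (v + v) ⟩
    0#                     ∎)
    where open ≡-Reasoning

  orderedPairs-unique : Unique (orderedPairs G)
  orderedPairs-unique = filter⁺ (λ p → proj₁ p <? proj₂ p)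
    (subst Unique (sym (concatMap-pairs≡cartesianProduct (allFin n) (allFin n)))
      (cartesianProduct⁺ (allFin⁺ n) (allFin⁺ n)))

  ∈-orderedPairs⁻ : ∀ {a b} → (a , b) ∈ₗ orderedPairs G → a < b
  ∈-orderedPairs⁻ p∈ = proj₂ (∈-filter⁻ (λ p → proj₁ p <? proj₂ p)
    {xs = concatMap (λ a → map (a ,_) (allFin n)) (allFin n)} p∈)

  IsDifference : Fin n → Fin n → Fin n → Set
  IsDifference d a b = a - b ≡ d ⊎ b - a ≡ d

  differences-≡± : ∀ {d d′ a b} → IsDifference d a b → IsDifference d′ a b → d ≡ d′ ⊎ d ≡ - d′
  differences-≡±             (inj₁ refl) (inj₁ a-b≡d′) = inj₁ a-b≡d′
  differences-≡±             (inj₂ refl) (inj₂ b-a≡d′) = inj₁ b-a≡d′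
  differences-≡± {a = a} {b} (inj₁ refl) (inj₂ refl) = inj₂ (sym (⁻¹-anti-homo‿- b a))
  differences-≡± {a = a} {b} (inj₂ refl) (inj₁ refl) = inj₂ (sym (⁻¹-anti-homo‿- a b))

  sum-and-difference⇒double : ∀ {s d a b} → a + b ≡ s → IsDifference d a b →
    a + a ≡ s + d ⊎ b + b ≡ s + d
  sum-and-difference⇒double {a = a} {b} refl (inj₁ refl) = inj₁ (sym (sum+difference≡double a b))
  sum-and-difference⇒double {a = a} {b} refl (inj₂ refl) =
    inj₂ (sym (trans (cong (_+ (b - a)) (comm a b)) (sum+difference≡double b a)))

  apex : Fin n → Fin n → Fin n → Fin n
  apex c a b = if does (a + a ≟ c) then a else b

  apex∈pair : ∀ c a b → apex c a b ≡ a ⊎ apex c a b ≡ b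
  apex∈pair c a b with a + a ≟ c
  ... | yes _ = inj₁ refl
  ... | no _  = inj₂ refl

  apex-double : ∀ c a b → a + a ≡ c ⊎ b + b ≡ c → apex c a b + apex c a b ≡ c
  apex-double c a b doubles with a + a ≟ c
  ... | yes aa≡c = aa≡c
  ... | no aa≢c  = [ (λ aa≡c → ⊥-elim (aa≢c aa≡c)) , (λ bb≡c → bb≡c) ]′ doubles

  sum-and-member⇒pair≡ : ∀ {a b a′ b′} u → a < b → a′ < b′ → a + b ≡ a′ + b′ →
    u ≡ a ⊎ u ≡ b → u ≡ a′ ⊎ u ≡ b′ → (a , b) ≡ (a′ , b′)
  sum-and-member⇒pair≡ u _ _ sum≡ (inj₁ refl) (inj₁ refl) = cong (u ,_) (∙-cancelˡ u _ _ sum≡)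
  sum-and-member⇒pair≡ u _ _ sum≡ (inj₂ refl) (inj₂ refl) = cong (_, u) (∙-cancelʳ u _ _ sum≡)
  sum-and-member⇒pair≡ {a} {b} {a′} {b′} u u<b a′<u sum≡ (inj₁ refl) (inj₂ refl) =
    ⊥-elim (<-asym u<b (subst (_< u) (sym b≡a′) a′<u))
    where
    b≡a′ : b ≡ a′
    b≡a′ = ∙-cancelˡ u b a′ (trans sum≡ (comm a′ u))
  sum-and-member⇒pair≡ {a} {b} {a′} {b′} u a<u u<b′ sum≡ (inj₂ refl) (inj₁ refl) =
    ⊥-elim (<-asym a<u (subst (u <_) b′≡a u<b′))
    where
    b′≡a : b′ ≡ a
    b′≡a = sym (∙-cancelˡ u a b′ (trans (comm u a) sum≡))

  sum-and-apex-injective : ∀ c {a b a′ b′} → a < b → a′ < b′ →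
    (a + b , apex c a b) ≡ (a′ + b′ , apex c a′ b′) → (a , b) ≡ (a′ , b′)
  sum-and-apex-injective c {a} {b} {a′} {b′} a<b a′<b′ images≡ =
    sum-and-member⇒pair≡ (apex c a b) a<b a′<b′ (cong proj₁ images≡) (apex∈pair c a b)
      (Sum.map (trans (cong proj₂ images≡)) (trans (cong proj₂ images≡)) (apex∈pair c a′ b′))

  module _ {E : Subset n} (E-index2 : IsIndex2Subgroup G E) where
    open IsIndex2Subgroup E-index2
    open IsSubgroup isSubgroup

    evens odds : List (Fin n)
    evens = filter (_∈? E) (allFin n)
    odds  = filter (∁? (_∈? E)) (allFin n)

    length-odds≡length-evens : length odds ≡ length evens
    length-odds≡length-evens = +-cancelˡ-≡ (length evens) _ _ (begin
      length evens ℕ.+ length odds   ≡⟨ length-filter+length-filter-∁ (_∈? E) (allFin n) ⟩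
      length (allFin n)              ≡⟨ length-tabulate (λ i → i) ⟩
      n                              ≡⟨ sym index2 ⟩
      2 * ∣ E ∣                      ≡⟨ cong (2 *_) (sym (length-filter-∈-allFin E)) ⟩
      2 * length evens               ≡⟨ cong (length evens ℕ.+_) (+-identityʳ (length evens)) ⟩
      length evens ℕ.+ length evens  ∎)
      where open ≡-Reasoning

    odd+even∉E : ∀ {a t} → a ∉ E → t ∈ E → a + t ∉ E
    odd+even∉E {a} {t} a∉E t∈E a+t∈E =
      a∉E (subst (_∈ E) (//-rightDividesʳ t a) (+-closed a+t∈E (neg-closed t∈E)))

    -- Otherwise b together with the coset a + E would give more odd elements than even ones.
    odd-difference∈E : ∀ {a b} → a ∉ E → b ∉ E → b - a ∈ E
    odd-difference∈E {a} {b} a∉E b∉E = decidable-stable (b - a ∈? E) λ b-a∉E →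
      <-irrefl (sym length-odds≡length-evens)
        (subst (λ k → suc k ≤ length odds) (length-map (a +_) evens)
          (injectiveOn⇒length≤ (λ z → z)
            (b∉a+E b-a∉E ∷ map⁺ (λ {t} {t′} → ∙-cancelˡ a t t′) (filter⁺ (_∈? E) (allFin⁺ n)))
            (λ _ _ z≡z′ → z≡z′)
            into-odds))
      where
      b∉a+E : b - a ∉ E → All (b ≢_) (map (a +_) evens)
      b∉a+E b-a∉E = All.tabulate λ z∈ b≡z →
        let t , t∈evens , z≡a+t = ∈-map⁻ (a +_) z∈ in
        b-a∉E (subst (_∈ E) (trans (sym (xyx⁻¹≈y a t)) (cong (_- a) (sym (trans b≡z z≡a+t))))
                 (proj₂ (∈-filter⁻ (_∈? E) {xs = allFin n} t∈evens)))
      into-odds : ∀ {z} → z ∈ₗ (b ∷ map (a +_) evens) → z ∈ₗ odds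
      into-odds (here refl) = ∈-filter⁺ (∁? (_∈? E)) (∈-allFin b) b∉E
      into-odds (there z∈) with ∈-map⁻ (a +_) z∈
      ... | t , t∈evens , refl = ∈-filter⁺ (∁? (_∈? E)) (∈-allFin (a + t))
        (odd+even∉E a∉E (proj₂ (∈-filter⁻ (_∈? E) {xs = allFin n} t∈evens)))

    selfInverseEvens : List (Fin n)
    selfInverseEvens = filter (λ t → (t ∈? E) ×-dec (t ≟ - t)) (allFin n)

    IsOddHalf : Fin n → Fin n → Set
    IsOddHalf c u = u ∉ E × u + u ≡ c

    isOddHalf? : ∀ c → Decidable (IsOddHalf c)
    isOddHalf? c u = ¬? (u ∈? E) ×-dec (u + u ≟ c)

    oddHalves : Fin n → List (Fin n)
    oddHalves c = filter (isOddHalf? c) (allFin n)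

    length-oddHalves≤r : ∀ c → length (oddHalves c) ≤ r G E
    length-oddHalves≤r c = bound (oddHalves c) (filter⁺ (isOddHalf? c) (allFin⁺ n))
      (λ u∈ → proj₂ (∈-filter⁻ (isOddHalf? c) {xs = allFin n} u∈))
      where
      bound : ∀ us → Unique us → (∀ {u} → u ∈ₗ us → IsOddHalf c u) →
        length us ≤ length selfInverseEvens
      bound []        _     _      = z≤n
      bound (u₀ ∷ us) us-uq halves =
        injectiveOn⇒length≤ (_- u₀) us-uq (λ _ _ → ∙-cancelʳ (- u₀) _ _) into-selfInverseEvens
        where
        into-selfInverseEvens : ∀ {u} → u ∈ₗ (u₀ ∷ us) → u - u₀ ∈ₗ selfInverseEvens
        into-selfInverseEvens {u} u∈ =
          let u∉E , uu≡c = halves u∈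
              u₀∉E , u₀u₀≡c = halves (here refl)
          in ∈-filter⁺ (λ t → (t ∈? E) ×-dec (t ≟ - t)) (∈-allFin (u - u₀))
               (odd-difference∈E u₀∉E u∉E
               , doubles≡⇒difference-selfInverse u u₀ (trans uu≡c (sym u₀u₀≡c)))

    module _ {x y : Fin n} (x≢y : x ≢ y) (x≢-y : x ≢ - y) where

      commonEdge-sum-difference : ∀ {a b} → IsEdge G E x a b → IsEdge G E y a b →
        (a + b ≡ x × IsDifference y a b) ⊎ (a + b ≡ y × IsDifference x a b)
      commonEdge-sum-difference (_ , _ , _ , inj₁ a+b≡x) (_ , _ , _ , inj₁ a+b≡y) =
        ⊥-elim (x≢y (trans (sym a+b≡x) a+b≡y))
      commonEdge-sum-difference (_ , _ , _ , inj₁ a+b≡x) (_ , _ , _ , inj₂ dy)     = inj₁ (a+b≡x , dy)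
      commonEdge-sum-difference (_ , _ , _ , inj₂ dx)     (_ , _ , _ , inj₁ a+b≡y) = inj₂ (a+b≡y , dx)
      commonEdge-sum-difference (_ , _ , _ , inj₂ dx)     (_ , _ , _ , inj₂ dy)     =
        ⊥-elim ([ x≢y , x≢-y ]′ (differences-≡± dx dy))

      commonEdge-sum : ∀ {a b} → IsEdge G E x a b → IsEdge G E y a b → a + b ∈ₗ (x ∷ y ∷ [])
      commonEdge-sum ex ey with commonEdge-sum-difference ex ey
      ... | inj₁ (a+b≡x , _) = here a+b≡x
      ... | inj₂ (a+b≡y , _) = there (here a+b≡y)

      commonEdge-double : ∀ {a b} → IsEdge G E x a b → IsEdge G E y a b →
        a + a ≡ x + y ⊎ b + b ≡ x + y
      commonEdge-double ex ey with commonEdge-sum-difference ex ey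
      ... | inj₁ (a+b≡x , dy) = sum-and-difference⇒double a+b≡x dy
      ... | inj₂ (a+b≡y , dx) =
        Sum.map (λ aa≡y+x → trans aa≡y+x (comm y x)) (λ bb≡y+x → trans bb≡y+x (comm y x))
          (sum-and-difference⇒double a+b≡y dx)

      isCommonEdge? : Decidable (λ (p : Fin n × Fin n) →
        IsEdge G E x (proj₁ p) (proj₂ p) × IsEdge G E y (proj₁ p) (proj₂ p))
      isCommonEdge? (a , b) = isEdge? G E x a b ×-dec isEdge? G E y a b

      commonEdgeList : List (Fin n × Fin n)
      commonEdgeList = filter isCommonEdge? (orderedPairs G)

      ∈-commonEdgeList⁻ : ∀ {a b} → (a , b) ∈ₗ commonEdgeList →
        a < b × IsEdge G E x a b × IsEdge G E y a b
      ∈-commonEdgeList⁻ p∈ =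
        let p∈pairs , edges = ∈-filter⁻ isCommonEdge? {xs = orderedPairs G} p∈
        in ∈-orderedPairs⁻ p∈pairs , edges

      edgeImage : Fin n × Fin n → Fin n × Fin n
      edgeImage (a , b) = a + b , apex (x + y) a b

      edgeImage-∈ : ∀ {a b} → IsEdge G E x a b → IsEdge G E y a b →
        edgeImage (a , b) ∈ₗ cartesianProduct (x ∷ y ∷ []) (oddHalves (x + y))
      edgeImage-∈ {a} {b} ex@(a∉E , b∉E , _) ey =
        ∈-cartesianProduct⁺ (commonEdge-sum ex ey)
          (∈-filter⁺ (isOddHalf? (x + y)) (∈-allFin _)
            (apex∉E , apex-double (x + y) a b (commonEdge-double ex ey)))
        where
        apex∉E : apex (x + y) a b ∉ E
        apex∉E = [ (λ apex≡a → subst (_∉ E) (sym apex≡a) a∉E)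
                 , (λ apex≡b → subst (_∉ E) (sym apex≡b) b∉E) ]′ (apex∈pair (x + y) a b)

      commonEdges≤2*oddHalves : commonEdges G E x y ≤ 2 * length (oddHalves (x + y))
      commonEdges≤2*oddHalves = begin
        length commonEdgeList
          ≤⟨ injectiveOn⇒length≤ edgeImage (filter⁺ isCommonEdge? orderedPairs-unique) injective into ⟩
        length (cartesianProduct (x ∷ y ∷ []) (oddHalves (x + y)))
          ≡⟨ length-cartesianProduct (x ∷ y ∷ []) (oddHalves (x + y)) ⟩
        2 * length (oddHalves (x + y)) ∎
        where
        open ≤-Reasoning
        injective : ∀ {p q} → p ∈ₗ commonEdgeList → q ∈ₗ commonEdgeList →
          edgeImage p ≡ edgeImage q → p ≡ q
        injective {_ , _} {_ , _} p∈ q∈ = sum-and-apex-injective (x + y)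
          (proj₁ (∈-commonEdgeList⁻ p∈)) (proj₁ (∈-commonEdgeList⁻ q∈))
        into : ∀ {p} → p ∈ₗ commonEdgeList →
          edgeImage p ∈ₗ cartesianProduct (x ∷ y ∷ []) (oddHalves (x + y))
        into {_ , _} p∈ = let _ , ex , ey = ∈-commonEdgeList⁻ p∈ in edgeImage-∈ ex ey

mainTheorem12 : (n : ℕ) (G : FinAbGroup n) (E : Subset n) →
    IsIndex2Subgroup G E →
    (x y : Fin n) → x ∈ E → y ∈ E →
    x ≢ y → x ≢ FinAbGroup.-_ G y →
    commonEdges G E x y ≤ 2 * r G E
mainTheorem12 n G E E-index2 x y _ _ x≢y x≢-y =
  ≤-trans (commonEdges≤2*oddHalves G E-index2 x≢y x≢-y)
          (*-monoʳ-≤ 2 (length-oddHalves≤r G E-index2 (FinAbGroup._+_ G x y)))
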